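{- Let $(a_n)_{n \ge 0}$ be the sequence defined by $a_0 = 0$ and $a_n = \frac{n}{2} a_{n-1} + (n-1)!$ for all $n \geq 1$. Then for every natural number $n$, $$G_n = \sum_{k=1}^{n} (-1)^{k-1} a_k\, S(n,k),$$ where $G_n$ are the Genocchi numbers and $S(n,k)$ are the Stirling numbers of the second kind.
   Context: The Stirling numbers of the second kind $S(n,k)$ ($0 \le k \le n$) are defined by the polynomial identity $X^n = \sum_{k=0}^{n} S(n,k)\, X(X-1)\cdots(X-k+1)$. The Genocchi numbers $G_n$ ($n \ge 0$) are defined by the exponential generating function $\frac{2x}{e^x+1} = \sum_{n=0}^{\infty} G_n \frac{x^n}{n!}$. -}

module Defs where

open import Data.Nat using (ℕ; zero; suc; _∸_; _!)
open import Data.Nat.Properties using (_!≢0)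
open import Data.Integer using (+_)
open import Data.Rational using (ℚ; _/_; _+_; _*_; _-_; -_; 0ℚ; 1ℚ; ½)
open import Relation.Binary.PropositionalEquality using (_≡_)

ℕ→ℚ : ℕ → ℚ
ℕ→ℚ n = + n / 1

∑ : ℕ → (ℕ → ℚ) → ℚ
∑ zero    f = 0ℚ
∑ (suc n) f = ∑ n f + f n

pow : ℚ → ℕ → ℚ
pow x zero    = 1ℚ
pow x (suc n) = pow x n * x

falling : ℚ → ℕ → ℚ
falling x zero    = 1ℚ
falling x (suc k) = falling x k * (x - ℕ→ℚ k)

invFact : ℕ → ℚ
invFact n = + 1 / (n !)
  where instance _ = n !≢0

Series : Set
Series = ℕ → ℚ

_⊛_ : Series → Series → Series
(f ⊛ g) n = ∑ (suc n) (λ k → f k * g (n ∸ k))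

_⊕_ : Series → Series → Series
(f ⊕ g) n = f n + g n

expS : Series
expS n = invFact n

oneS : Series
oneS zero    = 1ℚ
oneS (suc n) = 0ℚ

twoX : Series
twoX (suc zero) = ℕ→ℚ 2
twoX _          = 0ℚ

egf : (ℕ → ℚ) → Series
egf c n = c n * invFact n

-- G is the Genocchi sequence: 2x/(e^x+1) = Σ G_n x^n/n!, i.e.
-- (e^x + 1) · Σ G_n x^n/n! = 2x as formal power series
-- (e^x + 1 has constant term 2, hence is invertible, so this determines G).
IsGenocchi : (ℕ → ℚ) → Set
IsGenocchi G = ∀ n → ((expS ⊕ oneS) ⊛ egf G) n ≡ twoX n


-- S are the Stirling numbers of the second kind:
-- X^n = Σ_{k=0}^{n} S(n,k) X(X-1)...(X-k+1)  (as a polynomial identity,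
-- stated by evaluation at every rational X; ℚ is infinite so this is equivalent)
IsStirling2 : (ℕ → ℕ → ℚ) → Set
IsStirling2 S = ∀ n (x : ℚ) → pow x n ≡ ∑ (suc n) (λ k → S n k * falling x k)


a : ℕ → ℚ
a zero    = 0ℚ
a (suc m) = (ℕ→ℚ (suc m) * ½) * a m + ℕ→ℚ (m !)

signPred : ℕ → ℚ
signPred k = pow (- 1ℚ) (k ∸ 1)

{-# OPTIONS --safe #-}

-- Write f_j = (e^x - 1)^j / j!, whose coefficients are S(m,j) / m!, and
-- b_j = (-1)^(j-1) a_j.  Since e^x f_j = (j+1) f_(j+1) + f_j, we get
-- (e^x + 1) Σ b_j f_j = Σ (j b_(j-1) + 2 b_j) f_j, and the recursion of a
-- turns j b_(j-1) + 2 b_j into 2 (-1)^(j-1) (j-1)!.  Thus the right-hand side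
-- equals 2 log(1 + (e^x - 1)) = 2x, so Σ_n (Σ_j b_j S(n,j)) x^n / n! solves
-- the equation defining the Genocchi numbers, whose solution is unique.
-- The Stirling numbers are pinned down by the polynomial identity because
-- evaluating it at X = 0, 1, 2, ... is a triangular system with diagonal j!.

module Submission where

open import Defs
open import Data.Nat using (ℕ; suc)
open import Data.Rational using (ℚ; _*_)
open import Relation.Binary.PropositionalEquality using (_≡_)

open import Data.Nat as ℕ using (zero; _∸_; _!; _≤_; _<_; s≤s)
import Data.Nat.Properties as ℕ
open import Data.Nat.Induction using (<-rec)
open import Data.Sum using (inj₁; inj₂)
import Data.Integer as ℤ
import Data.Integer.Properties as ℤ
open import Data.Rational using (_+_; _-_; -_; 0ℚ; 1ℚ; ½; toℚᵘ; _/_)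
open import Data.Rational.Properties
import Data.Rational.Unnormalised as ℚᵘ
import Data.Rational.Unnormalised.Properties as ℚᵘ
open import Data.Rational.Solver using (module +-*-Solver)
open import Algebra.Properties.Group +-0-group using ()
  renaming (∙-cancelˡ to +-cancelˡ; ∙-cancelʳ to +-cancelʳ)
open import Relation.Binary.PropositionalEquality
  using (refl; sym; trans; cong; cong₂; module ≡-Reasoning)

open +-*-Solver

ℕ→ℚ-suc : ∀ n → ℕ→ℚ (suc n) ≡ 1ℚ + ℕ→ℚ n
ℕ→ℚ-suc n = toℚᵘ-injective (begin
  toℚᵘ (ℕ→ℚ (suc n))
    ≈⟨ toℚᵘ-fromℚᵘ (ℚᵘ.mkℚᵘ (ℤ.+ suc n) 0) ⟩
  ℚᵘ.mkℚᵘ (ℤ.+ suc n) 0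
    ≈⟨ ℚᵘ.*≡* (cong (ℤ._* ℤ.+ 1) (cong (ℤ._+_ (ℤ.+ 1)) (sym (ℤ.*-identityʳ (ℤ.+ n))))) ⟩
  ℚᵘ.1ℚᵘ ℚᵘ.+ ℚᵘ.mkℚᵘ (ℤ.+ n) 0
    ≈⟨ ℚᵘ.+-congʳ ℚᵘ.1ℚᵘ (ℚᵘ.≃-sym (toℚᵘ-fromℚᵘ (ℚᵘ.mkℚᵘ (ℤ.+ n) 0))) ⟩
  toℚᵘ 1ℚ ℚᵘ.+ toℚᵘ (ℕ→ℚ n)
    ≈⟨ ℚᵘ.≃-sym (toℚᵘ-homo-+ 1ℚ (ℕ→ℚ n)) ⟩
  toℚᵘ (1ℚ + ℕ→ℚ n)
    ∎)
  where open ℚᵘ.≃-Reasoning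

ℕ→ℚ-+ : ∀ m n → ℕ→ℚ (m ℕ.+ n) ≡ ℕ→ℚ m + ℕ→ℚ n
ℕ→ℚ-+ zero    n = sym (+-identityˡ (ℕ→ℚ n))
ℕ→ℚ-+ (suc m) n = begin
  ℕ→ℚ (suc (m ℕ.+ n))   ≡⟨ ℕ→ℚ-suc (m ℕ.+ n) ⟩
  1ℚ + ℕ→ℚ (m ℕ.+ n)    ≡⟨ cong (1ℚ +_) (ℕ→ℚ-+ m n) ⟩
  1ℚ + (ℕ→ℚ m + ℕ→ℚ n)  ≡⟨ sym (+-assoc 1ℚ (ℕ→ℚ m) (ℕ→ℚ n)) ⟩
  1ℚ + ℕ→ℚ m + ℕ→ℚ n    ≡⟨ cong (_+ ℕ→ℚ n) (sym (ℕ→ℚ-suc m)) ⟩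
  ℕ→ℚ (suc m) + ℕ→ℚ n   ∎
  where open ≡-Reasoning

ℕ→ℚ-* : ∀ m n → ℕ→ℚ (m ℕ.* n) ≡ ℕ→ℚ m * ℕ→ℚ n
ℕ→ℚ-* zero    n = sym (*-zeroˡ (ℕ→ℚ n))
ℕ→ℚ-* (suc m) n = begin
  ℕ→ℚ (n ℕ.+ m ℕ.* n)         ≡⟨ ℕ→ℚ-+ n (m ℕ.* n) ⟩
  ℕ→ℚ n + ℕ→ℚ (m ℕ.* n)       ≡⟨ cong₂ _+_ (sym (*-identityˡ (ℕ→ℚ n))) (ℕ→ℚ-* m n) ⟩
  1ℚ * ℕ→ℚ n + ℕ→ℚ m * ℕ→ℚ n  ≡⟨ sym (*-distribʳ-+ (ℕ→ℚ n) 1ℚ (ℕ→ℚ m)) ⟩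
  (1ℚ + ℕ→ℚ m) * ℕ→ℚ n        ≡⟨ cong (_* ℕ→ℚ n) (sym (ℕ→ℚ-suc m)) ⟩
  ℕ→ℚ (suc m) * ℕ→ℚ n         ∎
  where open ≡-Reasoning

ℕ→ℚ-*-inverse : ∀ d .{{_ : ℕ.NonZero d}} → ℕ→ℚ d * (ℤ.+ 1 / d) ≡ 1ℚ
ℕ→ℚ-*-inverse (suc d) = toℚᵘ-injective (begin
  toℚᵘ (ℕ→ℚ (suc d) * (ℤ.+ 1 / suc d))
    ≈⟨ toℚᵘ-homo-* (ℕ→ℚ (suc d)) (ℤ.+ 1 / suc d) ⟩
  toℚᵘ (ℕ→ℚ (suc d)) ℚᵘ.* toℚᵘ (ℤ.+ 1 / suc d)
    ≈⟨ ℚᵘ.*-cong (toℚᵘ-fromℚᵘ (ℚᵘ.mkℚᵘ (ℤ.+ suc d) 0))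
                 (toℚᵘ-fromℚᵘ (ℚᵘ.mkℚᵘ (ℤ.+ 1) d)) ⟩
  ℚᵘ.mkℚᵘ (ℤ.+ suc d) 0 ℚᵘ.* ℚᵘ.mkℚᵘ (ℤ.+ 1) d
    ≈⟨ ℚᵘ.*≡* (trans (ℤ.*-identityʳ (ℤ.+ suc d ℤ.* ℤ.+ 1)) (trans (ℤ.*-identityʳ (ℤ.+ suc d))
         (sym (trans (ℤ.*-identityˡ (ℤ.+ 1 ℤ.* ℤ.+ suc d)) (ℤ.*-identityˡ (ℤ.+ suc d)))))) ⟩
  ℚᵘ.1ℚᵘ
    ∎)
  where open ℚᵘ.≃-Reasoning

n!*invFact≡1 : ∀ n → ℕ→ℚ (n !) * invFact n ≡ 1ℚ
n!*invFact≡1 n = ℕ→ℚ-*-inverse (n !) {{n ℕ.!≢0}}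

*-cancelˡ-invertible : ∀ c d {x y} → c * d ≡ 1ℚ → c * x ≡ c * y → x ≡ y
*-cancelˡ-invertible c d {x} {y} c*d≡1 c*x≡c*y = begin
  x            ≡⟨ sym (*-identityˡ x) ⟩
  1ℚ * x       ≡⟨ cong (_* x) (trans (sym c*d≡1) (*-comm c d)) ⟩
  d * c * x    ≡⟨ *-assoc d c x ⟩
  d * (c * x)  ≡⟨ cong (d *_) c*x≡c*y ⟩
  d * (c * y)  ≡⟨ sym (*-assoc d c y) ⟩
  d * c * y    ≡⟨ cong (_* y) (trans (*-comm d c) c*d≡1) ⟩
  1ℚ * y       ≡⟨ *-identityˡ y ⟩
  y            ∎
  where open ≡-Reasoning

*-cancelʳ-invertible : ∀ c d {x y} → c * d ≡ 1ℚ → x * c ≡ y * c → x ≡ y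
*-cancelʳ-invertible c d {x} {y} c*d≡1 x*c≡y*c =
  *-cancelˡ-invertible c d c*d≡1 (trans (*-comm c x) (trans x*c≡y*c (*-comm y c)))

suc*invFact-suc : ∀ m → ℕ→ℚ (suc m) * invFact (suc m) ≡ invFact m
suc*invFact-suc m = *-cancelˡ-invertible (ℕ→ℚ (m !)) (invFact m) (n!*invFact≡1 m) (begin
  ℕ→ℚ (m !) * (ℕ→ℚ (suc m) * invFact (suc m))
    ≡⟨ solve 3 (λ f s i → f :* (s :* i) := (s :* f) :* i)
               refl (ℕ→ℚ (m !)) (ℕ→ℚ (suc m)) (invFact (suc m)) ⟩
  ℕ→ℚ (suc m) * ℕ→ℚ (m !) * invFact (suc m)
    ≡⟨ cong (_* invFact (suc m)) (sym (ℕ→ℚ-* (suc m) (m !))) ⟩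
  ℕ→ℚ (suc m !) * invFact (suc m)
    ≡⟨ trans (n!*invFact≡1 (suc m)) (sym (n!*invFact≡1 m)) ⟩
  ℕ→ℚ (m !) * invFact m
    ∎)
  where open ≡-Reasoning

∑-cong-< : ∀ n {f g : ℕ → ℚ} → (∀ k → k < n → f k ≡ g k) → ∑ n f ≡ ∑ n g
∑-cong-< zero    f≡g = refl
∑-cong-< (suc n) f≡g =
  cong₂ _+_ (∑-cong-< n (λ k k<n → f≡g k (ℕ.m<n⇒m<1+n k<n))) (f≡g n ℕ.≤-refl)

∑-cong : ∀ n {f g : ℕ → ℚ} → (∀ k → f k ≡ g k) → ∑ n f ≡ ∑ n g
∑-cong n f≡g = ∑-cong-< n (λ k _ → f≡g k)

∑-zero : ∀ n (f : ℕ → ℚ) → (∀ k → k < n → f k ≡ 0ℚ) → ∑ n f ≡ 0ℚ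
∑-zero zero    f f≡0 = refl
∑-zero (suc n) f f≡0 = trans
  (cong₂ _+_ (∑-zero n f (λ k k<n → f≡0 k (ℕ.m<n⇒m<1+n k<n))) (f≡0 n ℕ.≤-refl))
  (+-identityʳ 0ℚ)

∑-distrib-+ : ∀ n (f g : ℕ → ℚ) → ∑ n (λ k → f k + g k) ≡ ∑ n f + ∑ n g
∑-distrib-+ zero    f g = refl
∑-distrib-+ (suc n) f g = trans (cong (_+ (f n + g n)) (∑-distrib-+ n f g))
  (solve 4 (λ F G x y → (F :+ G) :+ (x :+ y) := (F :+ x) :+ (G :+ y))
           refl (∑ n f) (∑ n g) (f n) (g n))

∑-*ˡ : ∀ n c (f : ℕ → ℚ) → ∑ n (λ k → c * f k) ≡ c * ∑ n f
∑-*ˡ zero    c f = sym (*-zeroʳ c)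
∑-*ˡ (suc n) c f =
  trans (cong (_+ c * f n) (∑-*ˡ n c f)) (sym (*-distribˡ-+ c (∑ n f) (f n)))

∑-*ʳ : ∀ n c (f : ℕ → ℚ) → ∑ n (λ k → f k * c) ≡ ∑ n f * c
∑-*ʳ n c f = trans (∑-cong n (λ k → *-comm (f k) c)) (trans (∑-*ˡ n c f) (*-comm c (∑ n f)))

∑-suc-head : ∀ n (f : ℕ → ℚ) → ∑ (suc n) f ≡ f 0 + ∑ n (λ k → f (suc k))
∑-suc-head zero    f = trans (+-identityˡ (f 0)) (sym (+-identityʳ (f 0)))
∑-suc-head (suc n) f = trans (cong (_+ f (suc n)) (∑-suc-head n f))
  (+-assoc (f 0) (∑ n (λ k → f (suc k))) (f (suc n)))

∑-drop-last : ∀ n (f : ℕ → ℚ) → f n ≡ 0ℚ → ∑ (suc n) f ≡ ∑ n f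
∑-drop-last n f fn≡0 = trans (cong (∑ n f +_) fn≡0) (+-identityʳ (∑ n f))

∑-extend : ∀ {m n} (f : ℕ → ℚ) → m ≤ n → (∀ k → m ≤ k → f k ≡ 0ℚ) → ∑ n f ≡ ∑ m f
∑-extend f m≤n f≡0 with ℕ.m≤n⇒m<n∨m≡n m≤n
... | inj₂ refl        = refl
... | inj₁ (s≤s m≤n-1) =
  trans (∑-drop-last _ f (f≡0 _ m≤n-1)) (∑-extend f m≤n-1 f≡0)

∑-comm : ∀ n m (f : ℕ → ℕ → ℚ) →
         ∑ n (λ i → ∑ m (λ j → f i j)) ≡ ∑ m (λ j → ∑ n (λ i → f i j))
∑-comm zero    m f = sym (∑-zero m (λ _ → 0ℚ) (λ _ _ → refl))
∑-comm (suc n) m f = trans (cong (_+ ∑ m (f n)) (∑-comm n m f))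
  (sym (∑-distrib-+ m (λ j → ∑ n (λ i → f i j)) (f n)))

∑-oneS : ∀ n (f : ℕ → ℚ) → ∑ (suc n) (λ k → oneS k * f k) ≡ f 0
∑-oneS n f = begin
  ∑ (suc n) (λ k → oneS k * f k)
    ≡⟨ ∑-suc-head n _ ⟩
  1ℚ * f 0 + ∑ n (λ k → 0ℚ * f (suc k))
    ≡⟨ cong₂ _+_ (*-identityˡ (f 0)) (∑-zero n _ (λ k _ → *-zeroˡ (f (suc k)))) ⟩
  f 0 + 0ℚ
    ≡⟨ +-identityʳ (f 0) ⟩
  f 0
    ∎
  where open ≡-Reasoning

-- Stirling numbers of the second kind

-- shift g j = g (j - 1) and shift g 0 = 0: multiplication by x on coefficient sequences.
shift : (ℕ → ℚ) → ℕ → ℚ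
shift g zero    = 0ℚ
shift g (suc j) = g j

shift-*ʳ : ∀ g c j → shift g j * c ≡ shift (λ i → g i * c) j
shift-*ʳ g c zero    = *-zeroˡ c
shift-*ʳ g c (suc j) = refl

∑-shift : ∀ n g (c : ℕ → ℚ) → ∑ (suc n) (λ j → shift g j * c j) ≡ ∑ n (λ j → g j * c (suc j))
∑-shift n g c = begin
  ∑ (suc n) (λ j → shift g j * c j)
    ≡⟨ ∑-suc-head n _ ⟩
  0ℚ * c 0 + ∑ n (λ j → g j * c (suc j))
    ≡⟨ cong (_+ ∑ n (λ j → g j * c (suc j))) (*-zeroˡ (c 0)) ⟩
  0ℚ + ∑ n (λ j → g j * c (suc j))
    ≡⟨ +-identityˡ _ ⟩
  ∑ n (λ j → g j * c (suc j))
    ∎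
  where open ≡-Reasoning

stirling₂ : ℕ → ℕ → ℚ
stirling₂ zero    j = oneS j
stirling₂ (suc m) j = ℕ→ℚ j * stirling₂ m j + shift (stirling₂ m) j

stirling₂-zeroʳ : ∀ m → stirling₂ m 0 ≡ oneS m
stirling₂-zeroʳ zero    = refl
stirling₂-zeroʳ (suc m) = trans (+-identityʳ _) (*-zeroˡ (stirling₂ m 0))

stirling₂-vanishes : ∀ {m j} → m < j → stirling₂ m j ≡ 0ℚ
stirling₂-vanishes {zero}  {suc j} _         = refl
stirling₂-vanishes {suc m} {suc j} (s≤s m<j) = begin
  ℕ→ℚ (suc j) * stirling₂ m (suc j) + stirling₂ m j
    ≡⟨ cong₂ (λ s t → ℕ→ℚ (suc j) * s + t)
             (stirling₂-vanishes (ℕ.m<n⇒m<1+n m<j)) (stirling₂-vanishes m<j) ⟩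
  ℕ→ℚ (suc j) * 0ℚ + 0ℚ
    ≡⟨ trans (+-identityʳ _) (*-zeroʳ (ℕ→ℚ (suc j))) ⟩
  0ℚ
    ∎
  where open ≡-Reasoning

-- The recurrence of stirling₂, transposed to act on the column index.
∑-stirling₂-suc : ∀ m (c : ℕ → ℚ) →
  ∑ (suc (suc m)) (λ j → stirling₂ (suc m) j * c j) ≡
  ∑ (suc m) (λ j → stirling₂ m j * (ℕ→ℚ j * c j + c (suc j)))
∑-stirling₂-suc m c = begin
  ∑ (suc (suc m)) (λ j → (ℕ→ℚ j * S j + shift S j) * c j)
    ≡⟨ ∑-cong (suc (suc m)) (λ j → *-distribʳ-+ (c j) (ℕ→ℚ j * S j) (shift S j)) ⟩
  ∑ (suc (suc m)) (λ j → ℕ→ℚ j * S j * c j + shift S j * c j)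
    ≡⟨ ∑-distrib-+ (suc (suc m)) _ _ ⟩
  ∑ (suc (suc m)) (λ j → ℕ→ℚ j * S j * c j) + ∑ (suc (suc m)) (λ j → shift S j * c j)
    ≡⟨ cong₂ _+_ (∑-drop-last (suc m) _ top≡0) (∑-shift (suc m) S c) ⟩
  ∑ (suc m) (λ j → ℕ→ℚ j * S j * c j) + ∑ (suc m) (λ j → S j * c (suc j))
    ≡⟨ sym (∑-distrib-+ (suc m) _ _) ⟩
  ∑ (suc m) (λ j → ℕ→ℚ j * S j * c j + S j * c (suc j))
    ≡⟨ ∑-cong (suc m) (λ j → solve 4 (λ J s x y → J :* s :* x :+ s :* y := s :* (J :* x :+ y))
                                     refl (ℕ→ℚ j) (S j) (c j) (c (suc j))) ⟩
  ∑ (suc m) (λ j → S j * (ℕ→ℚ j * c j + c (suc j)))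
    ∎
  where
  open ≡-Reasoning
  S : ℕ → ℚ
  S = stirling₂ m
  top≡0 : ℕ→ℚ (suc m) * S (suc m) * c (suc m) ≡ 0ℚ
  top≡0 = begin
    ℕ→ℚ (suc m) * S (suc m) * c (suc m)
      ≡⟨ cong (λ s → ℕ→ℚ (suc m) * s * c (suc m)) (stirling₂-vanishes {m} ℕ.≤-refl) ⟩
    ℕ→ℚ (suc m) * 0ℚ * c (suc m)
      ≡⟨ cong (_* c (suc m)) (*-zeroʳ (ℕ→ℚ (suc m))) ⟩
    0ℚ * c (suc m)
      ≡⟨ *-zeroˡ (c (suc m)) ⟩
    0ℚ
      ∎

-- Falling factorials

falling*x : ∀ x k → falling x k * x ≡ ℕ→ℚ k * falling x k + falling x (suc k)
falling*x x k =
  solve 3 (λ f x K → f :* x := K :* f :+ f :* (x :- K)) refl (falling x k) x (ℕ→ℚ k)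

falling-unfoldˡ : ∀ x k → falling x (suc k) ≡ x * falling (x - 1ℚ) k
falling-unfoldˡ x zero    = solve 1 (λ x → con 1ℚ :* (x :- con 0ℚ) := x :* con 1ℚ) refl x
falling-unfoldˡ x (suc k) = begin
  falling x (suc k) * (x - ℕ→ℚ (suc k))
    ≡⟨ cong₂ (λ f K → f * (x - K)) (falling-unfoldˡ x k) (ℕ→ℚ-suc k) ⟩
  x * falling (x - 1ℚ) k * (x - (1ℚ + ℕ→ℚ k))
    ≡⟨ solve 3 (λ x f K → x :* f :* (x :- (con 1ℚ :+ K)) := x :* (f :* ((x :- con 1ℚ) :- K)))
               refl x (falling (x - 1ℚ) k) (ℕ→ℚ k) ⟩
  x * (falling (x - 1ℚ) k * ((x - 1ℚ) - ℕ→ℚ k))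
    ∎
  where open ≡-Reasoning

falling-vanishes : ∀ {j k} → j < k → falling (ℕ→ℚ j) k ≡ 0ℚ
falling-vanishes {j} {suc k} (s≤s j≤k) with ℕ.m≤n⇒m<n∨m≡n j≤k
... | inj₁ j<k  =
  trans (cong (_* (ℕ→ℚ j - ℕ→ℚ k)) (falling-vanishes j<k)) (*-zeroˡ (ℕ→ℚ j - ℕ→ℚ k))
... | inj₂ refl =
  trans (cong (falling (ℕ→ℚ j) j *_) (+-inverseʳ (ℕ→ℚ j))) (*-zeroʳ (falling (ℕ→ℚ j) j))

falling-diagonal : ∀ j → falling (ℕ→ℚ j) j ≡ ℕ→ℚ (j !)
falling-diagonal zero    = refl
falling-diagonal (suc j) = begin
  falling (ℕ→ℚ (suc j)) (suc j)
    ≡⟨ falling-unfoldˡ (ℕ→ℚ (suc j)) j ⟩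
  ℕ→ℚ (suc j) * falling (ℕ→ℚ (suc j) - 1ℚ) j
    ≡⟨ cong (λ x → ℕ→ℚ (suc j) * falling x j) suc-1 ⟩
  ℕ→ℚ (suc j) * falling (ℕ→ℚ j) j
    ≡⟨ cong (ℕ→ℚ (suc j) *_) (falling-diagonal j) ⟩
  ℕ→ℚ (suc j) * ℕ→ℚ (j !)
    ≡⟨ sym (ℕ→ℚ-* (suc j) (j !)) ⟩
  ℕ→ℚ (suc j !)
    ∎
  where
  open ≡-Reasoning
  suc-1 : ℕ→ℚ (suc j) - 1ℚ ≡ ℕ→ℚ j
  suc-1 = trans (cong (_- 1ℚ) (ℕ→ℚ-suc j))
                (solve 1 (λ J → con 1ℚ :+ J :- con 1ℚ := J) refl (ℕ→ℚ j))

falling-expansion-unique : ∀ n (e e′ : ℕ → ℚ) →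
  (∀ x → ∑ (suc n) (λ k → e k * falling x k) ≡ ∑ (suc n) (λ k → e′ k * falling x k)) →
  ∀ {j} → j ≤ n → e j ≡ e′ j
falling-expansion-unique n e e′ expansions-agree {j} = <-rec (λ j → j ≤ n → e j ≡ e′ j) step j
  where
  step : ∀ j → (∀ {i} → i < j → i ≤ n → e i ≡ e′ i) → j ≤ n → e j ≡ e′ j
  step j below j≤n = *-cancelʳ-invertible (ℕ→ℚ (j !)) (invFact j) (n!*invFact≡1 j)
      (trans (cong (e j *_) (sym (falling-diagonal j)))
      (trans (+-cancelˡ (∑ j (term e)) _ _ top-terms-agree)
             (cong (e′ j *_) (falling-diagonal j))))
    where
    term : (ℕ → ℚ) → ℕ → ℚ
    term c k = c k * falling (ℕ→ℚ j) k
    truncate : ∀ c → ∑ (suc n) (term c) ≡ ∑ j (term c) + term c j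
    truncate c = ∑-extend (term c) (s≤s j≤n)
      (λ k j<k → trans (cong (c k *_) (falling-vanishes j<k)) (*-zeroʳ (c k)))
    lower-sums-agree : ∑ j (term e) ≡ ∑ j (term e′)
    lower-sums-agree = ∑-cong-< j
      (λ i i<j → cong (_* falling (ℕ→ℚ j) i) (below i<j (ℕ.≤-trans (ℕ.<⇒≤ i<j) j≤n)))
    top-terms-agree : ∑ j (term e) + term e j ≡ ∑ j (term e) + term e′ j
    top-terms-agree = trans (sym (truncate e)) (trans (expansions-agree (ℕ→ℚ j))
      (trans (truncate e′) (cong (_+ term e′ j) (sym lower-sums-agree))))

pow≡∑stirling₂*falling : ∀ n x → pow x n ≡ ∑ (suc n) (λ k → stirling₂ n k * falling x k)
pow≡∑stirling₂*falling zero    x = refl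
pow≡∑stirling₂*falling (suc n) x = begin
  pow x n * x
    ≡⟨ cong (_* x) (pow≡∑stirling₂*falling n x) ⟩
  ∑ (suc n) (λ k → stirling₂ n k * falling x k) * x
    ≡⟨ sym (∑-*ʳ (suc n) x (λ k → stirling₂ n k * falling x k)) ⟩
  ∑ (suc n) (λ k → stirling₂ n k * falling x k * x)
    ≡⟨ ∑-cong (suc n) (λ k → trans (*-assoc (stirling₂ n k) (falling x k) x)
                                   (cong (stirling₂ n k *_) (falling*x x k))) ⟩
  ∑ (suc n) (λ k → stirling₂ n k * (ℕ→ℚ k * falling x k + falling x (suc k)))
    ≡⟨ sym (∑-stirling₂-suc n (falling x)) ⟩
  ∑ (suc (suc n)) (λ k → stirling₂ (suc n) k * falling x k)
    ∎
  where open ≡-Reasoning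

isStirling2⇒≡stirling₂ : ∀ {S} → IsStirling2 S → ∀ {n k} → k ≤ n → S n k ≡ stirling₂ n k
isStirling2⇒≡stirling₂ {S} isS {n} = falling-expansion-unique n (S n) (stirling₂ n)
  (λ x → trans (sym (isS n x)) (pow≡∑stirling₂*falling n x))

-- Exponential generating functions

deriv : Series → Series
deriv h m = ℕ→ℚ (suc m) * h (suc m)

⊛-congʳ : ∀ f {g h : Series} → (∀ m → g m ≡ h m) → ∀ n → (f ⊛ g) n ≡ (f ⊛ h) n
⊛-congʳ f g≡h n = ∑-cong (suc n) (λ k → cong (f k *_) (g≡h (n ∸ k)))

⊛-linearʳ : ∀ f g h c n → (f ⊛ (λ m → c * g m + h m)) n ≡ c * (f ⊛ g) n + (f ⊛ h) n
⊛-linearʳ f g h c n = begin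
  ∑ (suc n) (λ k → f k * (c * g (n ∸ k) + h (n ∸ k)))
    ≡⟨ ∑-cong (suc n) (λ k → solve 4 (λ F c G H → F :* (c :* G :+ H) := c :* (F :* G) :+ F :* H)
                                     refl (f k) c (g (n ∸ k)) (h (n ∸ k))) ⟩
  ∑ (suc n) (λ k → c * (f k * g (n ∸ k)) + f k * h (n ∸ k))
    ≡⟨ ∑-distrib-+ (suc n) _ _ ⟩
  ∑ (suc n) (λ k → c * (f k * g (n ∸ k))) + (f ⊛ h) n
    ≡⟨ cong (_+ (f ⊛ h) n) (∑-*ˡ (suc n) c (λ k → f k * g (n ∸ k))) ⟩
  c * (f ⊛ g) n + (f ⊛ h) n
    ∎
  where open ≡-Reasoning

⊛-distribʳ-⊕ : ∀ f g h n → ((f ⊕ g) ⊛ h) n ≡ (f ⊛ h) n + (g ⊛ h) n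
⊛-distribʳ-⊕ f g h n = trans
  (∑-cong (suc n) (λ k → *-distribʳ-+ (h (n ∸ k)) (f k) (g k)))
  (∑-distrib-+ (suc n) (λ k → f k * h (n ∸ k)) (λ k → g k * h (n ∸ k)))

⊛-identityˡ : ∀ h n → (oneS ⊛ h) n ≡ h n
⊛-identityˡ h n = ∑-oneS n (λ k → h (n ∸ k))

⊛-distribˡ-∑ : ∀ f (g : Series) (c : ℕ → ℚ) (h : ℕ → Series) N n →
  (∀ m → m ≤ n → g m ≡ ∑ N (λ j → c j * h j m)) →
  (f ⊛ g) n ≡ ∑ N (λ j → c j * (f ⊛ h j) n)
⊛-distribˡ-∑ f g c h N n g≡∑ = begin
  ∑ (suc n) (λ k → f k * g (n ∸ k))
    ≡⟨ ∑-cong (suc n) (λ k → cong (f k *_) (g≡∑ (n ∸ k) (ℕ.m∸n≤m n k))) ⟩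
  ∑ (suc n) (λ k → f k * ∑ N (λ j → c j * h j (n ∸ k)))
    ≡⟨ ∑-cong (suc n) (λ k → sym (∑-*ˡ N (f k) _)) ⟩
  ∑ (suc n) (λ k → ∑ N (λ j → f k * (c j * h j (n ∸ k))))
    ≡⟨ ∑-comm (suc n) N _ ⟩
  ∑ N (λ j → ∑ (suc n) (λ k → f k * (c j * h j (n ∸ k))))
    ≡⟨ ∑-cong N (λ j → trans (∑-cong (suc n) (λ k → swap (f k) (c j) _))
                             (∑-*ˡ (suc n) (c j) _)) ⟩
  ∑ N (λ j → c j * (f ⊛ h j) n)
    ∎
  where
  open ≡-Reasoning
  swap : ∀ x y z → x * (y * z) ≡ y * (x * z)
  swap = solve 3 (λ x y z → x :* (y :* z) := y :* (x :* z)) refl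

⊛-cancelˡ : ∀ f d {g h : Series} → f 0 * d ≡ 1ℚ →
  (∀ n → (f ⊛ g) n ≡ (f ⊛ h) n) → ∀ n → g n ≡ h n
⊛-cancelˡ f d {g} {h} f0*d≡1 f⊛g≡f⊛h = <-rec (λ n → g n ≡ h n) step
  where
  rest : Series → ℕ → ℚ
  rest u n = ∑ n (λ k → f (suc k) * u (n ∸ suc k))
  step : ∀ n → (∀ {m} → m < n → g m ≡ h m) → g n ≡ h n
  step n below = *-cancelˡ-invertible (f 0) d f0*d≡1 (+-cancelʳ (rest g n) _ _ (begin
    f 0 * g n + rest g n  ≡⟨ sym (∑-suc-head n _) ⟩
    (f ⊛ g) n             ≡⟨ f⊛g≡f⊛h n ⟩
    (f ⊛ h) n             ≡⟨ ∑-suc-head n _ ⟩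
    f 0 * h n + rest h n  ≡⟨ cong (f 0 * h n +_) (sym rests-agree) ⟩
    f 0 * h n + rest g n  ∎))
    where
    open ≡-Reasoning
    rests-agree : rest g n ≡ rest h n
    rests-agree = ∑-cong-< n (λ k k<n → cong (f (suc k) *_) (below (ℕ.∸-monoʳ-< ℕ.z<s k<n)))

-- Split the weight n + 1 as k + (n + 1 - k): since k / k! = 1 / (k - 1)!, the first
-- part differentiates e^x, and the second differentiates h.
deriv-exp⊛ : ∀ h n → deriv (expS ⊛ h) n ≡ (expS ⊛ h) n + (expS ⊛ deriv h) n
deriv-exp⊛ h n = begin
  ℕ→ℚ (suc n) * ∑ (suc (suc n)) (λ k → invFact k * h (suc n ∸ k))
    ≡⟨ sym (∑-*ˡ (suc (suc n)) (ℕ→ℚ (suc n)) _) ⟩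
  ∑ (suc (suc n)) (λ k → ℕ→ℚ (suc n) * (invFact k * h (suc n ∸ k)))
    ≡⟨ ∑-cong-< (suc (suc n)) split ⟩
  ∑ (suc (suc n)) (λ k → A k + B k)
    ≡⟨ ∑-distrib-+ (suc (suc n)) A B ⟩
  ∑ (suc (suc n)) A + ∑ (suc (suc n)) B
    ≡⟨ cong₂ _+_ ∑A ∑B ⟩
  (expS ⊛ h) n + (expS ⊛ deriv h) n
    ∎
  where
  open ≡-Reasoning
  A B : ℕ → ℚ
  A k = ℕ→ℚ k * invFact k * h (suc n ∸ k)
  B k = invFact k * (ℕ→ℚ (suc n ∸ k) * h (suc n ∸ k))
  split : ∀ k → k < suc (suc n) → ℕ→ℚ (suc n) * (invFact k * h (suc n ∸ k)) ≡ A k + B k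
  split k (s≤s k≤1+n) = begin
    ℕ→ℚ (suc n) * (invFact k * h (suc n ∸ k))
      ≡⟨ cong (λ i → ℕ→ℚ i * (invFact k * h (suc n ∸ k))) (sym (ℕ.m+[n∸m]≡n k≤1+n)) ⟩
    ℕ→ℚ (k ℕ.+ (suc n ∸ k)) * (invFact k * h (suc n ∸ k))
      ≡⟨ cong (_* (invFact k * h (suc n ∸ k))) (ℕ→ℚ-+ k (suc n ∸ k)) ⟩
    (ℕ→ℚ k + ℕ→ℚ (suc n ∸ k)) * (invFact k * h (suc n ∸ k))
      ≡⟨ solve 4 (λ K M i y → (K :+ M) :* (i :* y) := K :* i :* y :+ i :* (M :* y))
                 refl (ℕ→ℚ k) (ℕ→ℚ (suc n ∸ k)) (invFact k) (h (suc n ∸ k)) ⟩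
    A k + B k
      ∎
  ∑A : ∑ (suc (suc n)) A ≡ (expS ⊛ h) n
  ∑A = begin
    ∑ (suc (suc n)) A
      ≡⟨ ∑-suc-head (suc n) A ⟩
    0ℚ * h (suc n) + ∑ (suc n) (λ k → ℕ→ℚ (suc k) * invFact (suc k) * h (n ∸ k))
      ≡⟨ cong₂ _+_ (*-zeroˡ (h (suc n)))
                   (∑-cong (suc n) (λ k → cong (_* h (n ∸ k)) (suc*invFact-suc k))) ⟩
    0ℚ + (expS ⊛ h) n
      ≡⟨ +-identityˡ _ ⟩
    (expS ⊛ h) n
      ∎
  ∑B : ∑ (suc (suc n)) B ≡ (expS ⊛ deriv h) n
  ∑B = begin
    ∑ (suc (suc n)) B
      ≡⟨ ∑-drop-last (suc n) B B-top≡0 ⟩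
    ∑ (suc n) B
      ≡⟨ ∑-cong-< (suc n) (λ k k<1+n → cong (λ i → invFact k * (ℕ→ℚ i * h i))
                                            (ℕ.+-∸-assoc 1 (ℕ.<⇒≤pred k<1+n))) ⟩
    (expS ⊛ deriv h) n
      ∎
    where
    B-top≡0 : B (suc n) ≡ 0ℚ
    B-top≡0 = begin
      invFact (suc n) * (ℕ→ℚ (n ∸ n) * h (n ∸ n))
        ≡⟨ cong (λ i → invFact (suc n) * (ℕ→ℚ i * h i)) (ℕ.n∸n≡0 n) ⟩
      invFact (suc n) * (0ℚ * h 0)
        ≡⟨ cong (invFact (suc n) *_) (*-zeroˡ (h 0)) ⟩
      invFact (suc n) * 0ℚ
        ≡⟨ *-zeroʳ (invFact (suc n)) ⟩
      0ℚ
        ∎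

-- Columns of the Stirling triangle

-- column j = (e^x - 1)^j / j!, the exponential generating function of S(·, j).
column : ℕ → Series
column j m = stirling₂ m j * invFact m

prevColumn : ℕ → Series
prevColumn j m = shift (λ i → column i m) j

column-vanishes : ∀ {j m} → m < j → column j m ≡ 0ℚ
column-vanishes {j} {m} m<j =
  trans (cong (_* invFact m) (stirling₂-vanishes m<j)) (*-zeroˡ (invFact m))

deriv-column : ∀ j m → deriv (column j) m ≡ ℕ→ℚ j * column j m + prevColumn j m
deriv-column j m = begin
  ℕ→ℚ (suc m) * (T * invFact (suc m))
    ≡⟨ solve 3 (λ s t i → s :* (t :* i) := t :* (s :* i))
               refl (ℕ→ℚ (suc m)) T (invFact (suc m)) ⟩
  T * (ℕ→ℚ (suc m) * invFact (suc m))
    ≡⟨ cong (T *_) (suc*invFact-suc m) ⟩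
  (ℕ→ℚ j * S j + shift S j) * invFact m
    ≡⟨ *-distribʳ-+ (invFact m) (ℕ→ℚ j * S j) (shift S j) ⟩
  ℕ→ℚ j * S j * invFact m + shift S j * invFact m
    ≡⟨ cong₂ _+_ (*-assoc (ℕ→ℚ j) (S j) (invFact m)) (shift-*ʳ S (invFact m) j) ⟩
  ℕ→ℚ j * column j m + prevColumn j m
    ∎
  where
  open ≡-Reasoning
  S : ℕ → ℚ
  S = stirling₂ m
  T : ℚ
  T = stirling₂ (suc m) j

-- Multiplied by n + 1, the coefficients of index n + 1 of both sides become,
-- by deriv-exp⊛ and deriv-column, coefficients of index n.
exp⊛column : ∀ n j → (expS ⊛ column j) n ≡ ℕ→ℚ (suc j) * column (suc j) n + column j n
exp⊛column zero    j =
  solve 2 (λ J s → con 0ℚ :+ con 1ℚ :* (s :* con 1ℚ)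
                := J :* (con 0ℚ :* con 1ℚ) :+ s :* con 1ℚ)
          refl (ℕ→ℚ (suc j)) (oneS j)
exp⊛column (suc n) j =
  *-cancelˡ-invertible (ℕ→ℚ (suc n)) (ℤ.+ 1 / suc n) (ℕ→ℚ-*-inverse (suc n)) (begin
    deriv (expS ⊛ column j) n
      ≡⟨ deriv-exp⊛ (column j) n ⟩
    E + (expS ⊛ deriv (column j)) n
      ≡⟨ cong (E +_) (trans (⊛-congʳ expS (deriv-column j) n)
                            (⊛-linearʳ expS (column j) (prevColumn j) J n)) ⟩
    E + (J * E + (expS ⊛ prevColumn j) n)
      ≡⟨ cong₂ (λ u v → u + (J * u + v)) (exp⊛column n j) (exp⊛prevColumn j) ⟩
    X + (J * X + Q)
      ≡⟨ solve 3 (λ X J Q → X :+ (J :* X :+ Q) := (con 1ℚ :+ J) :* X :+ Q) refl X J Q ⟩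
    (1ℚ + J) * X + Q
      ≡⟨ cong₂ (λ s t → s * X + t) (sym (ℕ→ℚ-suc j)) (sym (deriv-column j n)) ⟩
    ℕ→ℚ (suc j) * X + deriv (column j) n
      ≡⟨ cong (λ t → ℕ→ℚ (suc j) * t + deriv (column j) n) (sym (deriv-column (suc j) n)) ⟩
    ℕ→ℚ (suc j) * deriv (column (suc j)) n + deriv (column j) n
      ≡⟨ solve 4 (λ J s x y → J :* (s :* x) :+ s :* y := s :* (J :* x :+ y))
                 refl (ℕ→ℚ (suc j)) (ℕ→ℚ (suc n)) (column (suc j) (suc n)) (column j (suc n)) ⟩
    ℕ→ℚ (suc n) * (ℕ→ℚ (suc j) * column (suc j) (suc n) + column j (suc n))
      ∎)
  where
  open ≡-Reasoning
  J E X Q : ℚ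
  J = ℕ→ℚ j
  E = (expS ⊛ column j) n
  X = ℕ→ℚ (suc j) * column (suc j) n + column j n
  Q = J * column j n + prevColumn j n
  exp⊛prevColumn : ∀ i → (expS ⊛ prevColumn i) n ≡ ℕ→ℚ i * column i n + prevColumn i n
  exp⊛prevColumn zero    = trans (∑-zero (suc n) _ (λ k _ → *-zeroʳ (invFact k)))
    (sym (trans (+-identityʳ _) (*-zeroˡ (column 0 n))))
  exp⊛prevColumn (suc i) = exp⊛column n i

stirling₂-transform : (ℕ → ℚ) → ℕ → ℚ
stirling₂-transform c n = ∑ (suc n) (λ j → c j * stirling₂ n j)

egf-stirling₂-transform : ∀ c {m n} → m ≤ n →
  egf (stirling₂-transform c) m ≡ ∑ (suc n) (λ j → c j * column j m)
egf-stirling₂-transform c {m} {n} m≤n = begin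
  ∑ (suc m) (λ j → c j * stirling₂ m j) * invFact m
    ≡⟨ sym (∑-*ʳ (suc m) (invFact m) _) ⟩
  ∑ (suc m) (λ j → c j * stirling₂ m j * invFact m)
    ≡⟨ ∑-cong (suc m) (λ j → *-assoc (c j) (stirling₂ m j) (invFact m)) ⟩
  ∑ (suc m) (λ j → c j * column j m)
    ≡⟨ sym (∑-extend (λ j → c j * column j m) (s≤s m≤n)
             (λ j m<j → trans (cong (c j *_) (column-vanishes m<j)) (*-zeroʳ (c j)))) ⟩
  ∑ (suc n) (λ j → c j * column j m)
    ∎
  where open ≡-Reasoning

exp+1⊛egf-stirling₂-transform : ∀ c n →
  ((expS ⊕ oneS) ⊛ egf (stirling₂-transform c)) n ≡
  ∑ (suc n) (λ j → (shift c j * ℕ→ℚ j + ℕ→ℚ 2 * c j) * column j n)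
exp+1⊛egf-stirling₂-transform c n = begin
  ((expS ⊕ oneS) ⊛ egf (stirling₂-transform c)) n
    ≡⟨ ⊛-distribˡ-∑ (expS ⊕ oneS) _ c column (suc n) n (λ _ → egf-stirling₂-transform c) ⟩
  ∑ (suc n) (λ j → c j * ((expS ⊕ oneS) ⊛ column j) n)
    ≡⟨ ∑-cong (suc n) (λ j → cong (c j *_) (exp+1⊛column j)) ⟩
  ∑ (suc n) (λ j → c j * (ℕ→ℚ (suc j) * column (suc j) n + column j n + column j n))
    ≡⟨ ∑-cong (suc n) (λ j → solve 4 (λ c J x y → c :* (J :* x :+ y :+ y)
                                                  := c :* (J :* x) :+ con (ℕ→ℚ 2) :* c :* y)
                                     refl (c j) (ℕ→ℚ (suc j)) (column (suc j) n) (column j n)) ⟩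
  ∑ (suc n) (λ j → c j * (ℕ→ℚ (suc j) * column (suc j) n) + ℕ→ℚ 2 * c j * column j n)
    ≡⟨ ∑-distrib-+ (suc n) _ _ ⟩
  ∑ (suc n) (λ j → c j * (ℕ→ℚ (suc j) * column (suc j) n))
    + ∑ (suc n) (λ j → ℕ→ℚ 2 * c j * column j n)
    ≡⟨ cong (_+ ∑ (suc n) (λ j → ℕ→ℚ 2 * c j * column j n)) reindex ⟩
  ∑ (suc n) (λ j → shift c j * (ℕ→ℚ j * column j n))
    + ∑ (suc n) (λ j → ℕ→ℚ 2 * c j * column j n)
    ≡⟨ sym (∑-distrib-+ (suc n) _ _) ⟩
  ∑ (suc n) (λ j → shift c j * (ℕ→ℚ j * column j n) + ℕ→ℚ 2 * c j * column j n)
    ≡⟨ ∑-cong (suc n) (λ j → solve 4 (λ s J c x → s :* (J :* x) :+ con (ℕ→ℚ 2) :* c :* x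
                                                  := (s :* J :+ con (ℕ→ℚ 2) :* c) :* x)
                                     refl (shift c j) (ℕ→ℚ j) (c j) (column j n)) ⟩
  ∑ (suc n) (λ j → (shift c j * ℕ→ℚ j + ℕ→ℚ 2 * c j) * column j n)
    ∎
  where
  open ≡-Reasoning
  exp+1⊛column : ∀ j → ((expS ⊕ oneS) ⊛ column j) n ≡
                       ℕ→ℚ (suc j) * column (suc j) n + column j n + column j n
  exp+1⊛column j = trans (⊛-distribʳ-⊕ expS oneS (column j) n)
    (cong₂ _+_ (exp⊛column n j) (⊛-identityˡ (column j) n))
  reindex : ∑ (suc n) (λ j → c j * (ℕ→ℚ (suc j) * column (suc j) n)) ≡
            ∑ (suc n) (λ j → shift c j * (ℕ→ℚ j * column j n))
  reindex = trans (sym (∑-shift (suc n) c (λ j → ℕ→ℚ j * column j n)))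
                  (∑-drop-last (suc n) _ top≡0)
    where
    top≡0 : shift c (suc n) * (ℕ→ℚ (suc n) * column (suc n) n) ≡ 0ℚ
    top≡0 = begin
      c n * (ℕ→ℚ (suc n) * column (suc n) n)
        ≡⟨ cong (λ t → c n * (ℕ→ℚ (suc n) * t)) (column-vanishes {suc n} ℕ.≤-refl) ⟩
      c n * (ℕ→ℚ (suc n) * 0ℚ)
        ≡⟨ cong (c n *_) (*-zeroʳ (ℕ→ℚ (suc n))) ⟩
      c n * 0ℚ
        ≡⟨ *-zeroʳ (c n) ⟩
      0ℚ
        ∎

-- The Genocchi numbers

signedA : ℕ → ℚ
signedA j = signPred j * a j

-- logCoeff j = (-1)^(j-1) (j-1)! is the coefficient of (e^x - 1)^j / j! in
-- log (1 + (e^x - 1)) = x.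
logCoeff : ℕ → ℚ
logCoeff zero    = 0ℚ
logCoeff (suc j) = signPred (suc j) * ℕ→ℚ (j !)

signedA-recurrence : ∀ j → shift signedA j * ℕ→ℚ j + ℕ→ℚ 2 * signedA j ≡ ℕ→ℚ 2 * logCoeff j
signedA-recurrence zero          = refl
signedA-recurrence (suc zero)    = refl
signedA-recurrence (suc (suc i)) =
  solve 4 (λ p A N F → p :* A :* N :+ con (ℕ→ℚ 2) :* ((p :* con (- 1ℚ)) :* ((N :* con ½) :* A :+ F))
                       := con (ℕ→ℚ 2) :* ((p :* con (- 1ℚ)) :* F))
          refl (pow (- 1ℚ) i) (a (suc i)) (ℕ→ℚ (suc (suc i))) (ℕ→ℚ (suc i !))

logCoeff-recurrence : ∀ j → ℕ→ℚ j * logCoeff j + logCoeff (suc j) ≡ oneS j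
logCoeff-recurrence zero    = refl
logCoeff-recurrence (suc i) = begin
  N * (p * F) + (p * - 1ℚ) * ℕ→ℚ (suc i !)
    ≡⟨ cong (λ t → N * (p * F) + (p * - 1ℚ) * t) (ℕ→ℚ-* (suc i) (i !)) ⟩
  N * (p * F) + (p * - 1ℚ) * (N * F)
    ≡⟨ solve 3 (λ N p F → N :* (p :* F) :+ (p :* con (- 1ℚ)) :* (N :* F) := con 0ℚ)
               refl N p F ⟩
  0ℚ
    ∎
  where
  open ≡-Reasoning
  p N F : ℚ
  p = pow (- 1ℚ) i
  N = ℕ→ℚ (suc i)
  F = ℕ→ℚ (i !)

∑-stirling₂*logCoeff : ∀ n → ∑ (suc n) (λ j → stirling₂ n j * logCoeff j) ≡ shift oneS n
∑-stirling₂*logCoeff zero    = refl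
∑-stirling₂*logCoeff (suc m) = begin
  ∑ (suc (suc m)) (λ j → stirling₂ (suc m) j * logCoeff j)
    ≡⟨ ∑-stirling₂-suc m logCoeff ⟩
  ∑ (suc m) (λ j → stirling₂ m j * (ℕ→ℚ j * logCoeff j + logCoeff (suc j)))
    ≡⟨ ∑-cong (suc m) (λ j → trans (cong (stirling₂ m j *_) (logCoeff-recurrence j))
                                   (*-comm (stirling₂ m j) (oneS j))) ⟩
  ∑ (suc m) (λ j → oneS j * stirling₂ m j)
    ≡⟨ ∑-oneS m (stirling₂ m) ⟩
  stirling₂ m 0
    ≡⟨ stirling₂-zeroʳ m ⟩
  oneS m
    ∎
  where open ≡-Reasoning

stirling₂-transform-signedA-isGenocchi : IsGenocchi (stirling₂-transform signedA)
stirling₂-transform-signedA-isGenocchi n = begin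
  ((expS ⊕ oneS) ⊛ egf (stirling₂-transform signedA)) n
    ≡⟨ exp+1⊛egf-stirling₂-transform signedA n ⟩
  ∑ (suc n) (λ j → (shift signedA j * ℕ→ℚ j + ℕ→ℚ 2 * signedA j) * column j n)
    ≡⟨ ∑-cong (suc n) (λ j → cong (_* column j n) (signedA-recurrence j)) ⟩
  ∑ (suc n) (λ j → ℕ→ℚ 2 * logCoeff j * (stirling₂ n j * invFact n))
    ≡⟨ ∑-cong (suc n) (λ j → solve 3 (λ l s i → con (ℕ→ℚ 2) :* l :* (s :* i)
                                              := con (ℕ→ℚ 2) :* i :* (s :* l))
                                     refl (logCoeff j) (stirling₂ n j) (invFact n)) ⟩
  ∑ (suc n) (λ j → ℕ→ℚ 2 * invFact n * (stirling₂ n j * logCoeff j))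
    ≡⟨ ∑-*ˡ (suc n) (ℕ→ℚ 2 * invFact n) _ ⟩
  ℕ→ℚ 2 * invFact n * ∑ (suc n) (λ j → stirling₂ n j * logCoeff j)
    ≡⟨ cong (ℕ→ℚ 2 * invFact n *_) (∑-stirling₂*logCoeff n) ⟩
  ℕ→ℚ 2 * invFact n * shift oneS n
    ≡⟨ 2*x≡twoX n ⟩
  twoX n
    ∎
  where
  open ≡-Reasoning
  2*x≡twoX : ∀ n → ℕ→ℚ 2 * invFact n * shift oneS n ≡ twoX n
  2*x≡twoX zero          = refl
  2*x≡twoX (suc zero)    = refl
  2*x≡twoX (suc (suc m)) = *-zeroʳ (ℕ→ℚ 2 * invFact (suc (suc m)))

isGenocchi-unique : ∀ {G H} → IsGenocchi G → IsGenocchi H → ∀ n → G n ≡ H n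
isGenocchi-unique {G} {H} isG isH n = *-cancelʳ-invertible (invFact n) (ℕ→ℚ (n !))
  (trans (*-comm (invFact n) (ℕ→ℚ (n !))) (n!*invFact≡1 n))
  (⊛-cancelˡ (expS ⊕ oneS) ½ {egf G} {egf H} refl (λ m → trans (isG m) (sym (isH m))) n)

corollary4 : (G : ℕ → ℚ) (S : ℕ → ℕ → ℚ) → IsGenocchi G → IsStirling2 S →
    ∀ n → G n ≡ ∑ n (λ i → signPred (suc i) * a (suc i) * S n (suc i))
corollary4 G S isG isS n = begin
  G n
    ≡⟨ isGenocchi-unique {G} {stirling₂-transform signedA}
                         isG stirling₂-transform-signedA-isGenocchi n ⟩
  stirling₂-transform signedA n
    ≡⟨ ∑-suc-head n (λ j → signedA j * stirling₂ n j) ⟩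
  signedA 0 * stirling₂ n 0 + ∑ n (λ i → signedA (suc i) * stirling₂ n (suc i))
    ≡⟨ cong (_+ ∑ n (λ i → signedA (suc i) * stirling₂ n (suc i))) (*-zeroˡ (stirling₂ n 0)) ⟩
  0ℚ + ∑ n (λ i → signedA (suc i) * stirling₂ n (suc i))
    ≡⟨ +-identityˡ _ ⟩
  ∑ n (λ i → signedA (suc i) * stirling₂ n (suc i))
    ≡⟨ ∑-cong-< n (λ i i<n → cong (signedA (suc i) *_)
                                  (sym (isStirling2⇒≡stirling₂ {S} isS i<n))) ⟩
  ∑ n (λ i → signPred (suc i) * a (suc i) * S n (suc i))
    ∎
  where open ≡-Reasoning
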